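{- Let $G=(V,E)$ be a finite simple graph. Then $$Sb_2(G)\le \min\{\deg(u)+\deg(v)+\deg(w)-\sigma(u,v,w)\},$$ where the minimum is taken over all sets $\{u,v,w\}\subseteq V$ of three vertices such that $v$ is adjacent to both $u$ and $w$, and $\sigma(u,v,w)$ is the number of edges of the subgraph induced on $\{u,v,w\}$.
   Context: $\gamma(G)$ is the domination number of $G$ (minimum size of a dominating set). $Sb_2(G)$ is the minimum size of a set $\mathcal{E}\subseteq E$ such that $\gamma(G-\mathcal{E})=\gamma(G)+2$. -}

module Defs where

open import Data.Nat using (ℕ; zero; suc; _+_; _∸_; _≤_; _<ᵇ_)
open import Data.Fin using (Fin; toℕ)
import Data.Fin as F
open import Data.Bool using (Bool; true; false; _∧_; not; if_then_else_)

open import Data.Product using (Σ; ∃-syntax; _×_; _,_)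
open import Data.Sum using (_⊎_)
open import Relation.Binary.PropositionalEquality using (_≡_; refl; cong₂)

record Graph (n : ℕ) : Set where
  field
    adj    : Fin n → Fin n → Bool
    adj-sym    : ∀ i j → adj i j ≡ adj j i
    adj-irrefl : ∀ i → adj i i ≡ false
open Graph public

count : ∀ {n} → (Fin n → Bool) → ℕ
count {zero}  f = 0
count {suc n} f = (if f F.zero then 1 else 0) + count (λ i → f (F.suc i))

deg : ∀ {n} → Graph n → Fin n → ℕ
deg G v = count (adj G v)

edge? : ∀ {n} → Graph n → Fin n → Fin n → ℕ
edge? G x y = if adj G x y then 1 else 0

σ : ∀ {n} → Graph n → Fin n → Fin n → Fin n → ℕ
σ G u v w = edge? G u v + edge? G v w + edge? G u w

VSet : ℕ → Set
VSet n = Fin n → Bool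

size : ∀ {n} → VSet n → ℕ
size S = count S

Dominating : ∀ {n} → Graph n → VSet n → Set
Dominating G S = ∀ x → S x ≡ true ⊎ (∃[ y ] (S y ≡ true × adj G y x ≡ true))

IsDominationNumber : ∀ {n} → Graph n → ℕ → Set
IsDominationNumber G k =
  (∃[ S ] (Dominating G S × size S ≡ k)) × (∀ S → Dominating G S → k ≤ size S)

record EdgeSet {n : ℕ} (G : Graph n) : Set where
  field
    mem     : Fin n → Fin n → Bool
    mem-sym : ∀ i j → mem i j ≡ mem j i
    mem-sub : ∀ i j → mem i j ≡ true → adj G i j ≡ true
open EdgeSet public

sumFin : ∀ {n} → (Fin n → ℕ) → ℕ
sumFin {zero}  f = 0
sumFin {suc n} f = f F.zero + sumFin (λ i → f (F.suc i))

-- number of edges in an edge set (each unordered pair {i,j}, i < j, counted once)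
esize : ∀ {n} {G : Graph n} → EdgeSet G → ℕ
esize E = sumFin (λ i → count (λ j → mem E i j ∧ (toℕ i <ᵇ toℕ j)))

irrefl-del : ∀ {n} (G : Graph n) (E : EdgeSet G) → ∀ i → adj G i i ∧ not (mem E i i) ≡ false
irrefl-del G E i with adj G i i | adj-irrefl G i
... | false | refl = refl

_─_ : ∀ {n} (G : Graph n) → EdgeSet G → Graph n
G ─ E = record
  { adj        = λ i j → adj G i j ∧ not (mem E i j)
  ; adj-sym    = λ i j → cong₂ (λ a b → a ∧ not b) (adj-sym G i j) (mem-sym E i j)
  ; adj-irrefl = irrefl-del G E
  }

Bondage2Witness : ∀ {n} (G : Graph n) → EdgeSet G → Set
Bondage2Witness G E = ∃[ a ] (IsDominationNumber G a × IsDominationNumber (G ─ E) (a + 2))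

IsSb2 : ∀ {n} → Graph n → ℕ → Set
IsSb2 G s =
  (∃[ E ] (Bondage2Witness G E × esize E ≡ s)) ×
  (∀ E → Bondage2Witness G E → s ≤ esize E)

module Submission where

-- Let T = {u, v, w} and let I be the set of edges with an endpoint in T. In G − I the
-- vertices of T are isolated, so every dominating set S of G − I contains T; since v
-- dominates u and w in G, S ∖ {u, w} dominates G, hence γ(G − I) ≥ γ(G) + 2. Deleting a
-- single edge raises γ by at most one (add one endpoint of it to a dominating set), so
-- deleting the edges of I one at a time passes through some E ⊆ I with
-- γ(G − E) = γ(G) + 2 exactly; thus Sb₂(G) ≤ |I|. Double counting edge ends gives
-- |I| + σ(u, v, w) = deg u + deg v + deg w. Sb₂(G) itself exists as the least size of a
-- witness, found by exhaustive search over the finitely many edge sets.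

open import Defs
open import Data.Bool using (Bool; true; false; _∧_; _∨_; not; if_then_else_)
open import Data.Bool.Properties using (∧-identityʳ; ∧-zeroʳ; ∨-zeroʳ; ∧-comm; ∨-comm)
  renaming (_≟_ to _≟ᴮ_)
open import Data.Fin using (Fin; zero; suc; toℕ; combine; remQuot)
open import Data.Fin.Properties using (_≟_; toℕ-injective; all?; any?; remQuot-combine)
open import Data.Fin.Subset.Properties using (anySubset?)
open import Data.List using (List; []; _∷_; cartesianProduct; allFin)
open import Data.List.Membership.Propositional.Properties using (∈-cartesianProduct⁺; ∈-allFin)
import Data.List.Relation.Unary.Any as List
import Data.Nat as ℕ
open import Data.Nat using (ℕ; zero; suc; _+_; _*_; _∸_; _≤_; _<_; _<ᵇ_; z≤n; s≤s)
open import Data.Nat.Properties hiding (_≟_)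
open import Data.Nat.Solver using (module +-*-Solver)
open +-*-Solver using (solve; _:=_; _:+_; _:*_; con)
open import Algebra.Properties.Semiring.Sum +-*-semiring
open import Data.Product using (∃; ∃-syntax; _×_; _,_; proj₁; proj₂; uncurry)
open import Data.Product.Properties using (≡-dec)
open import Data.Sum using (_⊎_; inj₁; inj₂; [_,_])
open import Data.Vec using (lookup; tabulate)
open import Data.Vec.Properties using (lookup∘tabulate)
open import Function using (_∘_)
open import Relation.Binary.Definitions using (DecidableEquality)
open import Relation.Binary.PropositionalEquality
  using (_≡_; _≢_; _≗_; refl; sym; trans; cong; cong₂; subst; module ≡-Reasoning)
open import Relation.Nullary using (Dec; yes; no; ¬_; does; contradiction; ofʸ; ofⁿ)
open import Relation.Nullary.Decidable using (map′; dec-true; dec-false; _⊎-dec_; _×-dec_)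
open import Relation.Unary using (Decidable)

∧-elimˡ : ∀ {a b} → a ∧ b ≡ true → a ≡ true
∧-elimˡ {true} _ = refl

∧-elimʳ : ∀ {a b} → a ∧ b ≡ true → b ≡ true
∧-elimʳ {true} b≡true = b≡true

∧-monoˡ : ∀ {a a′ b} → (a ≡ true → a′ ≡ true) → a ∧ b ≡ true → a′ ∧ b ≡ true
∧-monoˡ {true} a⇒a′ a∧b rewrite a⇒a′ refl = a∧b

∧-not-∧ : ∀ a t → a ∧ not (t ∧ a) ≡ true → t ≡ false
∧-not-∧ true false _ = refl

∨-falseˡ : ∀ {a b} → a ∨ b ≡ false → a ≡ false
∨-falseˡ {false} _ = refl

∨-falseʳ : ∀ {a b} → a ∨ b ≡ false → b ≡ false
∨-falseʳ {false} b≡false = b≡false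

χ : Bool → ℕ
χ b = if b then 1 else 0

χ-mono : ∀ {a b} → (a ≡ true → b ≡ true) → χ a ≤ χ b
χ-mono {false} _   = z≤n
χ-mono {true}  a⇒b rewrite a⇒b refl = ≤-refl

χ-∨ : ∀ a b → χ (a ∨ b) ≤ χ a + χ b
χ-∨ true  b = s≤s z≤n
χ-∨ false b = ≤-refl

χ-∧ : ∀ a b → χ (a ∧ b) ≡ χ a * χ b
χ-∧ true  b = sym (+-identityʳ (χ b))
χ-∧ false b = refl

χ-∨-∧ : ∀ x y a → χ ((x ∨ y) ∧ a) + χ ((x ∧ y) ∧ a) ≡ χ (x ∧ a) + χ (y ∧ a)
χ-∨-∧ true  true  a = refl
χ-∨-∧ true  false a = refl
χ-∨-∧ false y     a = +-identityʳ (χ (y ∧ a))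

χ-orient : ∀ {n} r (i j : Fin n) → (r ≡ true → i ≢ j) →
           χ (r ∧ (toℕ i <ᵇ toℕ j)) + χ (r ∧ (toℕ j <ᵇ toℕ i)) ≡ χ r
χ-orient false i j _ = refl
χ-orient true  i j r⇒i≢j
  with toℕ i <ᵇ toℕ j | <ᵇ-reflects-< (toℕ i) (toℕ j)
     | toℕ j <ᵇ toℕ i | <ᵇ-reflects-< (toℕ j) (toℕ i)
... | true  | ofʸ i<j | true  | ofʸ j<i = contradiction j<i (<-asym i<j)
... | true  | _       | false | _       = refl
... | false | _       | true  | _       = refl
... | false | ofⁿ i≮j | false | ofⁿ j≮i =
  contradiction (toℕ-injective (≤-antisym (≮⇒≥ j≮i) (≮⇒≥ i≮j))) (r⇒i≢j refl)

sumFin≡∑ : ∀ {n} (f : Fin n → ℕ) → sumFin f ≡ ∑[ i < n ] f i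
sumFin≡∑ {zero}  f = refl
sumFin≡∑ {suc n} f = cong (f zero +_) (sumFin≡∑ (λ i → f (suc i)))

count≡∑ : ∀ {n} (f : Fin n → Bool) → count f ≡ ∑[ i < n ] χ (f i)
count≡∑ {zero}  f = refl
count≡∑ {suc n} f = cong (χ (f zero) +_) (count≡∑ (λ i → f (suc i)))

count-cong : ∀ {n} {f g : Fin n → Bool} → f ≗ g → count f ≡ count g
count-cong {zero}  f≗g = refl
count-cong {suc n} f≗g = cong₂ _+_ (cong χ (f≗g zero)) (count-cong (λ i → f≗g (suc i)))

∑-mono-≤ : ∀ {n} {f g : Fin n → ℕ} → (∀ i → f i ≤ g i) → ∑[ i < n ] f i ≤ ∑[ i < n ] g i
∑-mono-≤ {zero}  f≤g = z≤n
∑-mono-≤ {suc n} f≤g = +-mono-≤ (f≤g zero) (∑-mono-≤ (λ i → f≤g (suc i)))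

∑∑-distrib-+ : ∀ {m n} (f g : Fin m → Fin n → ℕ) →
               ∑[ i < m ] ∑[ j < n ] (f i j + g i j) ≡
               ∑[ i < m ] ∑[ j < n ] f i j + ∑[ i < m ] ∑[ j < n ] g i j
∑∑-distrib-+ {n = n} f g =
  trans (sum-cong-≗ (λ i → ∑-distrib-+ (f i) (g i)))
        (∑-distrib-+ (λ i → ∑[ j < n ] f i j) (λ i → ∑[ j < n ] g i j))

module _ (P : ℕ → Set) (P? : Decidable P) where

  private
    least-below : ∀ m → (∃[ k ] (P k × ∀ j → P j → k ≤ j)) ⊎ (∀ j → j < m → ¬ P j)
    least-below zero = inj₂ (λ _ ())
    least-below (suc m) with least-below m
    ... | inj₁ found = inj₁ found
    ... | inj₂ none with P? m
    ...   | yes pm = inj₁ (m , pm , λ j pj → ≮⇒≥ (λ j<m → none j j<m pj))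
    ...   | no ¬pm = inj₂ λ j j<1+m → [ none j , (λ { refl → ¬pm }) ] (m<1+n⇒m<n∨m≡n j<1+m)

  least : ∀ {m} → P m → ∃[ k ] (P k × ∀ j → P j → k ≤ j)
  least {m} pm with least-below (suc m)
  ... | inj₁ found = found
  ... | inj₂ none  = contradiction pm (none m ≤-refl)

any-subset? : ∀ {n} {P : VSet n → Set} → (∀ {S T} → S ≗ T → P S → P T) →
              (∀ S → Dec (P S)) → Dec (∃ P)
any-subset? resp P? =
  map′ (λ (v , p) → lookup v , p)
       (λ (S , p) → tabulate S , resp (λ i → sym (lookup∘tabulate S i)) p)
       (anySubset? (λ v → P? (lookup v)))

any-relation? : ∀ {n} {P : (Fin n → Fin n → Bool) → Set} →
                (∀ {r s} → (∀ i j → r i j ≡ s i j) → P r → P s) →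
                (∀ r → Dec (P r)) → Dec (∃ P)
any-relation? {n} resp P? =
  map′ (λ (f , p) → curried f , p)
       (λ (r , p) → (λ k → uncurry r (remQuot n k)) ,
                    resp (λ i j → sym (cong (uncurry r) (remQuot-combine i j))) p)
       (any-subset? (λ f≗g → resp (λ i j → f≗g (combine i j))) (λ f → P? (curried f)))
  where
  curried : (Fin (n * n) → Bool) → Fin n → Fin n → Bool
  curried f i j = f (combine i j)

⁅_⁆ : ∀ {n} → Fin n → VSet n
⁅ x ⁆ i = does (i ≟ x)

_∪_ : ∀ {n} → VSet n → VSet n → VSet n
(S ∪ T) i = S i ∨ T i

_∖_ : ∀ {n} → VSet n → Fin n → VSet n
(S ∖ x) i = S i ∧ not (does (i ≟ x))

triple : ∀ {n} → Fin n → Fin n → Fin n → VSet n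
triple u v w = ⁅ u ⁆ ∪ (⁅ v ⁆ ∪ ⁅ w ⁆)

x∈⁅x⁆ : ∀ {n} (x : Fin n) → ⁅ x ⁆ x ≡ true
x∈⁅x⁆ x = dec-true (x ≟ x) refl

∪-introˡ : ∀ {n} (S T : VSet n) i → S i ≡ true → (S ∪ T) i ≡ true
∪-introˡ S T i Si rewrite Si = refl

∪-introʳ : ∀ {n} (S T : VSet n) i → T i ≡ true → (S ∪ T) i ≡ true
∪-introʳ S T i Ti rewrite Ti = ∨-zeroʳ (S i)

∈-∖ : ∀ {n} (S : VSet n) {i x} → S i ≡ true → i ≢ x → (S ∖ x) i ≡ true
∈-∖ S {i} {x} Si i≢x rewrite dec-false (i ≟ x) i≢x = trans (∧-identityʳ (S i)) Si

∑-⁅⁆ : ∀ {n} (x : Fin n) (h : Fin n → ℕ) → ∑[ i < n ] (χ (⁅ x ⁆ i) * h i) ≡ h x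
∑-⁅⁆ {suc n} zero    h = trans (cong₂ _+_ (+-identityʳ (h zero)) (sum-replicate-zero n))
                               (+-identityʳ (h zero))
∑-⁅⁆ {suc n} (suc x) h = ∑-⁅⁆ x (λ i → h (suc i))

count-⁅⁆ : ∀ {n} (x : Fin n) → count ⁅ x ⁆ ≡ 1
count-⁅⁆ {n} x = begin
  count ⁅ x ⁆                   ≡⟨ count≡∑ ⁅ x ⁆ ⟩
  ∑[ i < n ] χ (⁅ x ⁆ i)        ≡⟨ sum-cong-≗ (λ i → sym (*-identityʳ (χ (⁅ x ⁆ i)))) ⟩
  ∑[ i < n ] (χ (⁅ x ⁆ i) * 1)  ≡⟨ ∑-⁅⁆ x (λ _ → 1) ⟩
  1                             ∎
  where open ≡-Reasoning

count-∪ : ∀ {n} (S T : VSet n) → count (S ∪ T) ≤ count S + count T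
count-∪ {n} S T = begin
  count (S ∪ T)                            ≡⟨ count≡∑ (S ∪ T) ⟩
  ∑[ i < n ] χ (S i ∨ T i)                 ≤⟨ ∑-mono-≤ (λ i → χ-∨ (S i) (T i)) ⟩
  ∑[ i < n ] (χ (S i) + χ (T i))           ≡⟨ ∑-distrib-+ (λ i → χ (S i)) (λ i → χ (T i)) ⟩
  ∑[ i < n ] χ (S i) + ∑[ i < n ] χ (T i)  ≡⟨ sym (cong₂ _+_ (count≡∑ S) (count≡∑ T)) ⟩
  count S + count T                        ∎
  where open ≤-Reasoning

count-∪⁅⁆ : ∀ {n} (S : VSet n) (x : Fin n) → count (S ∪ ⁅ x ⁆) ≤ suc (count S)
count-∪⁅⁆ S x = begin
  count (S ∪ ⁅ x ⁆)      ≤⟨ count-∪ S ⁅ x ⁆ ⟩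
  count S + count ⁅ x ⁆  ≡⟨ cong (count S +_) (count-⁅⁆ x) ⟩
  count S + 1            ≡⟨ +-comm (count S) 1 ⟩
  suc (count S)          ∎
  where open ≤-Reasoning

count-∖ : ∀ {n} (S : VSet n) {x} → S x ≡ true → count S ≡ suc (count (S ∖ x))
count-∖ {suc n} S {zero} Sx rewrite Sx =
  cong suc (count-cong (λ i → sym (∧-identityʳ (S (suc i)))))
count-∖ {suc n} S {suc x} Sx = begin
  χ (S zero) + count (λ i → S (suc i))  ≡⟨ cong (χ (S zero) +_) (count-∖ (λ i → S (suc i)) Sx) ⟩
  χ (S zero) + suc c                    ≡⟨ +-suc (χ (S zero)) c ⟩
  suc (χ (S zero) + c)                  ≡⟨ cong (λ b → suc (χ b + c)) (sym (∧-identityʳ (S zero))) ⟩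
  suc (χ (S zero ∧ true) + c)           ∎
  where
  open ≡-Reasoning
  c = count ((λ i → S (suc i)) ∖ x)

_≈ᴳ_ : ∀ {n} → Graph n → Graph n → Set
G ≈ᴳ H = ∀ i j → adj G i j ≡ adj H i j

adj⇒≢ : ∀ {n} (G : Graph n) {x y} → adj G x y ≡ true → x ≢ y
adj⇒≢ G {x} x~y refl = contradiction (trans (sym x~y) (adj-irrefl G x)) λ ()

Dominating-cong : ∀ {n} {G H : Graph n} {S T : VSet n} → G ≈ᴳ H → S ≗ T →
                  Dominating G S → Dominating H T
Dominating-cong G≈H S≗T dom x with dom x
... | inj₁ Sx             = inj₁ (trans (sym (S≗T x)) Sx)
... | inj₂ (y , Sy , y~x) = inj₂ (y , trans (sym (S≗T y)) Sy , trans (sym (G≈H y x)) y~x)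

dominating? : ∀ {n} (H : Graph n) (S : VSet n) → Dec (Dominating H S)
dominating? H S =
  all? λ x → (S x ≟ᴮ true) ⊎-dec any? (λ y → (S y ≟ᴮ true) ×-dec (adj H y x ≟ᴮ true))

isolated∈dominating : ∀ {n} {H : Graph n} {S : VSet n} {x} →
                      (∀ y → adj H y x ≢ true) → Dominating H S → S x ≡ true
isolated∈dominating {x = x} isolated domS with domS x
... | inj₁ Sx            = Sx
... | inj₂ (y , _ , y~x) = contradiction y~x (isolated y)

domination-number : ∀ {n} (H : Graph n) → ∃ (IsDominationNumber H)
domination-number {n} H =
  let k , has , minimal = least HasDominatingSetOfSize has-size? everything-dominates
  in  k , has , λ S dom → minimal (size S) (S , dom , refl)
  where
  HasDominatingSetOfSize : ℕ → Set
  HasDominatingSetOfSize k = ∃[ S ] (Dominating H S × size S ≡ k)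

  has-size? : Decidable HasDominatingSetOfSize
  has-size? k =
    any-subset? (λ S≗T (dom , |S|≡k) → Dominating-cong {G = H} {H} (λ _ _ → refl) S≗T dom ,
                                        trans (sym (count-cong S≗T)) |S|≡k)
                (λ S → dominating? H S ×-dec (size S ℕ.≟ k))

  everything-dominates : HasDominatingSetOfSize (size {n} (λ _ → true))
  everything-dominates = (λ _ → true) , (λ _ → inj₁ refl) , refl

IsDominationNumber-unique : ∀ {n} {H : Graph n} {k l} →
                            IsDominationNumber H k → IsDominationNumber H l → k ≡ l
IsDominationNumber-unique ((S , domS , refl) , minimalS) ((T , domT , refl) , minimalT) =
  ≤-antisym (minimalS T domT) (minimalT S domS)

IsDominationNumber-cong : ∀ {n} {G H : Graph n} {k} → G ≈ᴳ H →
                          IsDominationNumber G k → IsDominationNumber H k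
IsDominationNumber-cong {G = G} {H} G≈H ((S , domS , |S|≡k) , minimal) =
  (S , Dominating-cong {G = G} {H} G≈H (λ _ → refl) domS , |S|≡k) ,
  λ T domT → minimal T (Dominating-cong {G = H} {G} (λ i j → sym (G≈H i j)) (λ _ → refl) domT)

γ : ∀ {n} → Graph n → ℕ
γ H = proj₁ (domination-number H)

γ-spec : ∀ {n} (H : Graph n) → IsDominationNumber H (γ H)
γ-spec H = proj₂ (domination-number H)

module _ {n} {G : Graph n} where

  _≈ᴱ_ : EdgeSet G → EdgeSet G → Set
  E ≈ᴱ F = ∀ i j → mem E i j ≡ mem F i j

  _⊆ᴱ_ : EdgeSet G → EdgeSet G → Set
  E ⊆ᴱ F = ∀ i j → mem E i j ≡ true → mem F i j ≡ true

  private
    _≺_ : Fin n → Fin n → Bool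
    i ≺ j = toℕ i <ᵇ toℕ j

  esize≡∑∑ : (E : EdgeSet G) → esize E ≡ ∑[ i < n ] ∑[ j < n ] χ (mem E i j ∧ i ≺ j)
  esize≡∑∑ E = trans (sumFin≡∑ {n} _) (sum-cong-≗ {n} (λ i → count≡∑ {n} _))

  esize-cong : {E F : EdgeSet G} → E ≈ᴱ F → esize E ≡ esize F
  esize-cong {E} {F} E≈F = begin
    esize E                                      ≡⟨ esize≡∑∑ E ⟩
    ∑[ i < n ] ∑[ j < n ] χ (mem E i j ∧ i ≺ j)  ≡⟨ sum-cong-≗ (λ i → sum-cong-≗ λ j →
                                                      cong (λ b → χ (b ∧ i ≺ j)) (E≈F i j)) ⟩
    ∑[ i < n ] ∑[ j < n ] χ (mem F i j ∧ i ≺ j)  ≡⟨ esize≡∑∑ F ⟨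
    esize F                                      ∎
    where open ≡-Reasoning

  esize-mono : {E F : EdgeSet G} → E ⊆ᴱ F → esize E ≤ esize F
  esize-mono {E} {F} E⊆F = begin
    esize E                                      ≡⟨ esize≡∑∑ E ⟩
    ∑[ i < n ] ∑[ j < n ] χ (mem E i j ∧ i ≺ j)  ≤⟨ ∑-mono-≤ (λ i → ∑-mono-≤ λ j →
                                                      χ-mono (∧-monoˡ (E⊆F i j))) ⟩
    ∑[ i < n ] ∑[ j < n ] χ (mem F i j ∧ i ≺ j)  ≡⟨ esize≡∑∑ F ⟨
    esize F                                      ∎
    where open ≤-Reasoning

  handshake : (E : EdgeSet G) → 2 * esize E ≡ ∑[ i < n ] ∑[ j < n ] χ (mem E i j)
  handshake E = begin
    2 * esize E
      ≡⟨ cong (esize E +_) (+-identityʳ (esize E)) ⟩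
    esize E + esize E
      ≡⟨ cong₂ _+_ (esize≡∑∑ E)
                   (trans (esize≡∑∑ E) (∑-comm (λ i j → χ (mem E i j ∧ i ≺ j)))) ⟩
    ∑[ i < n ] ∑[ j < n ] χ (mem E i j ∧ i ≺ j) + ∑[ i < n ] ∑[ j < n ] χ (mem E j i ∧ j ≺ i)
      ≡⟨ cong (∑[ i < n ] ∑[ j < n ] χ (mem E i j ∧ i ≺ j) +_)
              (sum-cong-≗ λ i → sum-cong-≗ λ j → cong (λ b → χ (b ∧ j ≺ i)) (mem-sym E j i)) ⟩
    ∑[ i < n ] ∑[ j < n ] χ (mem E i j ∧ i ≺ j) + ∑[ i < n ] ∑[ j < n ] χ (mem E i j ∧ j ≺ i)
      ≡⟨ ∑∑-distrib-+ (λ i j → χ (mem E i j ∧ i ≺ j)) (λ i j → χ (mem E i j ∧ j ≺ i)) ⟨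
    ∑[ i < n ] ∑[ j < n ] (χ (mem E i j ∧ i ≺ j) + χ (mem E i j ∧ j ≺ i))
      ≡⟨ sum-cong-≗ (λ i → sum-cong-≗ λ j →
           χ-orient (mem E i j) i j (adj⇒≢ G ∘ mem-sub E i j)) ⟩
    ∑[ i < n ] ∑[ j < n ] χ (mem E i j)
      ∎
    where open ≡-Reasoning

  ─-cong : {E F : EdgeSet G} → E ≈ᴱ F → (G ─ E) ≈ᴳ (G ─ F)
  ─-cong E≈F i j = cong (λ m → adj G i j ∧ not m) (E≈F i j)

  Bondage2Witness-cong : {E F : EdgeSet G} → E ≈ᴱ F → Bondage2Witness G E → Bondage2Witness G F
  Bondage2Witness-cong {E} {F} E≈F (a , γG , γG─E) =
    a , γG , IsDominationNumber-cong {G = G ─ E} {G ─ F} (─-cong {E} {F} E≈F) γG─E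

  bondage2Witness? : (E : EdgeSet G) → Dec (Bondage2Witness G E)
  bondage2Witness? E =
    map′ (λ eq → γ G , γ-spec G , subst (IsDominationNumber (G ─ E)) eq (γ-spec (G ─ E)))
         (λ (a , γG , γG─E) → trans (IsDominationNumber-unique {H = G ─ E} (γ-spec (G ─ E)) γG─E)
                                    (cong (_+ 2) (IsDominationNumber-unique {H = G} γG (γ-spec G))))
         (γ (G ─ E) ℕ.≟ γ G + 2)

  -- Relations carry no proof obligations, so unlike edge sets they can be searched exhaustively.
  edgeSetOf : (Fin n → Fin n → Bool) → EdgeSet G
  edgeSetOf r = record
    { mem     = λ i j → (r i j ∧ r j i) ∧ adj G i j
    ; mem-sym = λ i j → cong₂ _∧_ (∧-comm (r i j) (r j i)) (adj-sym G i j)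
    ; mem-sub = λ i j → ∧-elimʳ
    }

  edgeSetOf-cong : {r s : Fin n → Fin n → Bool} → (∀ i j → r i j ≡ s i j) →
                   edgeSetOf r ≈ᴱ edgeSetOf s
  edgeSetOf-cong r≈s i j = cong₂ (λ a b → (a ∧ b) ∧ adj G i j) (r≈s i j) (r≈s j i)

  edgeSetOf-mem : (E : EdgeSet G) → edgeSetOf (mem E) ≈ᴱ E
  edgeSetOf-mem E i j with mem E i j in eq
  ... | false = refl
  ... | true  = cong₂ _∧_ (trans (mem-sym E j i) eq) (mem-sub E i j eq)

  Sb₂-exists : (E : EdgeSet G) → Bondage2Witness G E → ∃[ s ] (IsSb2 G s × s ≤ esize E)
  Sb₂-exists E witness =
    let s , has , minimal = least HasWitnessOfSize has-witness? (E , witness , refl)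
    in  s , (has , λ F wF → minimal (esize F) (F , wF , refl)) ,
        minimal (esize E) (E , witness , refl)
    where
    HasWitnessOfSize : ℕ → Set
    HasWitnessOfSize k = ∃[ F ] (Bondage2Witness G F × esize F ≡ k)

    resp : ∀ {k r s} → (∀ i j → r i j ≡ s i j) →
           Bondage2Witness G (edgeSetOf r) × esize (edgeSetOf r) ≡ k →
           Bondage2Witness G (edgeSetOf s) × esize (edgeSetOf s) ≡ k
    resp {r = r} {s} r≈s (wr , |r|≡k) =
      Bondage2Witness-cong {edgeSetOf r} {edgeSetOf s} (edgeSetOf-cong r≈s) wr ,
      trans (sym (esize-cong {edgeSetOf r} {edgeSetOf s} (edgeSetOf-cong r≈s))) |r|≡k

    has-witness? : Decidable HasWitnessOfSize
    has-witness? k =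
      map′ (λ (r , wr , |r|≡k) → edgeSetOf r , wr , |r|≡k)
           (λ (F , wF , |F|≡k) →
              mem F ,
              Bondage2Witness-cong {F} {edgeSetOf (mem F)} (λ i j → sym (edgeSetOf-mem F i j)) wF ,
              trans (esize-cong {edgeSetOf (mem F)} {F} (edgeSetOf-mem F)) |F|≡k)
           (any-relation? resp λ r → bondage2Witness? (edgeSetOf r) ×-dec (esize (edgeSetOf r) ℕ.≟ k))

KeepsEdgesExcept : ∀ {n} → Graph n → Graph n → Fin n → Fin n → Set
KeepsEdgesExcept H H′ a b =
  ∀ i j → adj H i j ≡ true → adj H′ i j ≡ true ⊎ (i , j) ≡ (a , b) ⊎ (j , i) ≡ (a , b)

dominating-after-deletion :
  ∀ {n} {H H′ : Graph n} {a b : Fin n} {S T : VSet n} → KeepsEdgesExcept H H′ a b →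
  (∀ i → S i ≡ true → T i ≡ true) →
  (S a ≡ true → T b ≡ true) → (S b ≡ true → T a ≡ true) →
  Dominating H S → Dominating H′ T
dominating-after-deletion keeps S⊆T cover-b cover-a domS x with domS x
... | inj₁ Sx = inj₁ (S⊆T x Sx)
... | inj₂ (y , Sy , y~x) with keeps y x y~x
...   | inj₁ y~′x        = inj₂ (y , S⊆T y Sy , y~′x)
...   | inj₂ (inj₁ refl) = inj₁ (cover-b Sy)
...   | inj₂ (inj₂ refl) = inj₁ (cover-a Sy)

IsDominationNumber-delete-edge :
  ∀ {n} {H H′ : Graph n} (a b : Fin n) {k k′} → KeepsEdgesExcept H H′ a b →
  IsDominationNumber H k → IsDominationNumber H′ k′ → k′ ≤ suc k
IsDominationNumber-delete-edge {H = H} {H′} a b keeps ((S , domS , refl) , _) (_ , minimal)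
  with S a in Sa
... | true  = ≤-trans (minimal (S ∪ ⁅ b ⁆) (dominating-after-deletion {H = H} {H′} keeps
                         (∪-introˡ S ⁅ b ⁆)
                         (λ _ → ∪-introʳ S ⁅ b ⁆ b (x∈⁅x⁆ b))
                         (λ _ → ∪-introˡ S ⁅ b ⁆ a Sa)
                         domS))
                      (count-∪⁅⁆ S b)
... | false = ≤-trans (minimal (S ∪ ⁅ a ⁆) (dominating-after-deletion {H = H} {H′} keeps
                         (∪-introˡ S ⁅ a ⁆)
                         (λ Sa≡true → contradiction (trans (sym Sa≡true) Sa) λ ())
                         (λ _ → ∪-introʳ S ⁅ a ⁆ a (x∈⁅x⁆ a))
                         domS))
                      (count-∪⁅⁆ S a)

module _ {n} (G : Graph n) (T : VSet n) where

  incident : EdgeSet G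
  incident = record
    { mem     = λ i j → (T i ∨ T j) ∧ adj G i j
    ; mem-sym = λ i j → cong₂ _∧_ (∨-comm (T i) (T j)) (adj-sym G i j)
    ; mem-sub = λ i j → ∧-elimʳ
    }

  inside : EdgeSet G
  inside = record
    { mem     = λ i j → (T i ∧ T j) ∧ adj G i j
    ; mem-sym = λ i j → cong₂ _∧_ (∧-comm (T i) (T j)) (adj-sym G i j)
    ; mem-sub = λ i j → ∧-elimʳ
    }

  incident-deleted : ∀ i j → adj (G ─ incident) i j ≡ true → T i ∨ T j ≡ false
  incident-deleted i j = ∧-not-∧ (adj G i j) (T i ∨ T j)

  incident-isolates : ∀ {x} → T x ≡ true → ∀ y → adj (G ─ incident) y x ≢ true
  incident-isolates {x} Tx y y~x =
    contradiction (trans (sym (∨-falseʳ (incident-deleted y x y~x))) Tx) λ ()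

module _ {n} {G : Graph n} {u v w : Fin n} (v~u : adj G v u ≡ true) (v~w : adj G v w ≡ true) where

  private
    T : VSet n
    T = triple u v w

    u∈T : T u ≡ true
    u∈T = ∪-introˡ ⁅ u ⁆ (⁅ v ⁆ ∪ ⁅ w ⁆) u (x∈⁅x⁆ u)

    v∈T : T v ≡ true
    v∈T = ∪-introʳ ⁅ u ⁆ (⁅ v ⁆ ∪ ⁅ w ⁆) v (∪-introˡ ⁅ v ⁆ ⁅ w ⁆ v (x∈⁅x⁆ v))

    w∈T : T w ≡ true
    w∈T = ∪-introʳ ⁅ u ⁆ (⁅ v ⁆ ∪ ⁅ w ⁆) w (∪-introʳ ⁅ v ⁆ ⁅ w ⁆ w (x∈⁅x⁆ w))

    ∉T⇒≢ : ∀ x y → T x ≡ false → T y ≡ true → x ≢ y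
    ∉T⇒≢ x y Tx Ty refl = contradiction (trans (sym Tx) Ty) λ ()

    T⊆dominating : ∀ {S x} → Dominating (G ─ incident G T) S → T x ≡ true → S x ≡ true
    T⊆dominating domS Tx = isolated∈dominating {H = G ─ incident G T} (incident-isolates G T Tx) domS

    v∈S∖u∖w : ∀ {S} → Dominating (G ─ incident G T) S → ((S ∖ u) ∖ w) v ≡ true
    v∈S∖u∖w {S} domS =
      ∈-∖ (S ∖ u) (∈-∖ S (T⊆dominating domS v∈T) (adj⇒≢ G v~u)) (adj⇒≢ G v~w)

  dominating-without-u-w : ∀ {S} → Dominating (G ─ incident G T) S → Dominating G ((S ∖ u) ∖ w)
  dominating-without-u-w {S} domS x with x ≟ u | x ≟ w
  ... | yes refl | _        = inj₂ (v , v∈S∖u∖w domS , v~u)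
  ... | no _     | yes refl = inj₂ (v , v∈S∖u∖w domS , v~w)
  ... | no _     | no _ with domS x
  ...   | inj₁ Sx rewrite Sx  = inj₁ refl
  ...   | inj₂ (y , Sy , y~x) =
    inj₂ (y , ∈-∖ (S ∖ u) (∈-∖ S Sy (∉T⇒≢ y u Ty u∈T)) (∉T⇒≢ y w Ty w∈T) ,
          ∧-elimˡ y~x)
    where
    Ty : T y ≡ false
    Ty = ∨-falseˡ (incident-deleted G T y x y~x)

  isolating-triple-adds-two : u ≢ w → ∀ {a b} → IsDominationNumber G a →
                              IsDominationNumber (G ─ incident G (triple u v w)) b → a + 2 ≤ b
  isolating-triple-adds-two u≢w {a} (_ , minimal) ((S , domS , refl) , _) = begin
    a + 2
      ≤⟨ +-monoˡ-≤ 2 (minimal ((S ∖ u) ∖ w) (dominating-without-u-w domS)) ⟩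
    count ((S ∖ u) ∖ w) + 2
      ≡⟨ +-comm (count ((S ∖ u) ∖ w)) 2 ⟩
    2 + count ((S ∖ u) ∖ w)
      ≡⟨ cong suc (count-∖ (S ∖ u) {w} (∈-∖ S (T⊆dominating domS w∈T) (u≢w ∘ sym))) ⟨
    suc (count (S ∖ u))
      ≡⟨ count-∖ S {u} (T⊆dominating domS u∈T) ⟨
    count S
      ∎
    where open ≤-Reasoning

intermediate-value : ∀ {A : Set} (f : List A → ℕ) {t} →
                     f [] ≤ t → (∀ x xs → f (x ∷ xs) ≤ suc (f xs)) →
                     ∀ xs → t ≤ f xs → ∃[ ys ] f ys ≡ t
intermediate-value f f[]≤t step []       t≤f[] = [] , ≤-antisym f[]≤t t≤f[]
intermediate-value f {t} f[]≤t step (x ∷ xs) t≤f with t ≤? f xs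
... | yes t≤fxs = intermediate-value f f[]≤t step xs t≤fxs
... | no  t≰fxs = x ∷ xs , ≤-antisym (≤-trans (step x xs) (≰⇒> t≰fxs)) t≤f

allPairs : ∀ {n} → List (Fin n × Fin n)
allPairs {n} = cartesianProduct (allFin n) (allFin n)

module _ {n} {G : Graph n} where

  private
    _≟ₚ_ : DecidableEquality (Fin n × Fin n)
    _≟ₚ_ = ≡-dec _≟_ _≟_

    listed : List (Fin n × Fin n) → Fin n → Fin n → Bool
    listed ps i j = does (List.any? ((i , j) ≟ₚ_) ps)

  restrictTo : EdgeSet G → List (Fin n × Fin n) → EdgeSet G
  restrictTo E ps = record
    { mem     = λ i j → mem E i j ∧ (listed ps i j ∨ listed ps j i)
    ; mem-sym = λ i j → cong₂ _∧_ (mem-sym E i j) (∨-comm (listed ps i j) (listed ps j i))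
    ; mem-sub = λ i j → mem-sub E i j ∘ ∧-elimˡ
    }

  restrictTo-⊆ : (E : EdgeSet G) (ps : List (Fin n × Fin n)) → restrictTo E ps ⊆ᴱ E
  restrictTo-⊆ E ps i j = ∧-elimˡ

  ─-restrictTo-[] : (E : EdgeSet G) → (G ─ restrictTo E []) ≈ᴳ G
  ─-restrictTo-[] E i j =
    trans (cong (λ b → adj G i j ∧ not b) (∧-zeroʳ (mem E i j))) (∧-identityʳ (adj G i j))

  restrictTo-allPairs : (E : EdgeSet G) → restrictTo E allPairs ≈ᴱ E
  restrictTo-allPairs E i j =
    trans (cong (λ b → mem E i j ∧ (b ∨ listed allPairs j i))
                (dec-true (List.any? ((i , j) ≟ₚ_) allPairs)
                          (∈-cartesianProduct⁺ (∈-allFin i) (∈-allFin j))))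
          (∧-identityʳ (mem E i j))

  ─-restrictTo-∷ : (E : EdgeSet G) (a b : Fin n) (ps : List (Fin n × Fin n)) →
                   KeepsEdgesExcept (G ─ restrictTo E ps) (G ─ restrictTo E ((a , b) ∷ ps)) a b
  ─-restrictTo-∷ E a b ps i j i~j with (i , j) ≟ₚ (a , b) | (j , i) ≟ₚ (a , b)
  ... | yes ij≡ab | _         = inj₂ (inj₁ ij≡ab)
  ... | no _      | yes ji≡ab = inj₂ (inj₂ ji≡ab)
  ... | no _      | no _      = inj₁ i~j

bondage2-witness-within-incident :
  ∀ {n} {G : Graph n} {u v w} → u ≢ w → adj G v u ≡ true → adj G v w ≡ true →
  ∃[ E ] (Bondage2Witness G E × E ⊆ᴱ incident G (triple u v w))
bondage2-witness-within-incident {n} {G} {u} {v} {w} u≢w v~u v~w =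
  let ps , γ≡γG+2 =
        intermediate-value γ-after γ-after-[]≤γG+2 γ-after-step allPairs γG+2≤γ-after-all
  in  restrictTo I ps ,
      (γ G , γ-spec G , subst (IsDominationNumber (G ─ restrictTo I ps)) γ≡γG+2 (γ-spec _)) ,
      restrictTo-⊆ I ps
  where
  I : EdgeSet G
  I = incident G (triple u v w)

  γ-after : List (Fin n × Fin n) → ℕ
  γ-after ps = γ (G ─ restrictTo I ps)

  γ-after-[]≤γG+2 : γ-after [] ≤ γ G + 2
  γ-after-[]≤γG+2 =
    ≤-trans (≤-reflexive (IsDominationNumber-unique {H = G}
              (IsDominationNumber-cong {G = G ─ restrictTo I []} {G} (─-restrictTo-[] I) (γ-spec _))
              (γ-spec G)))
            (m≤m+n (γ G) 2)

  γ-after-step : ∀ p ps → γ-after (p ∷ ps) ≤ suc (γ-after ps)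
  γ-after-step (a , b) ps =
    IsDominationNumber-delete-edge {H = G ─ restrictTo I ps} {G ─ restrictTo I ((a , b) ∷ ps)} a b
      (─-restrictTo-∷ I a b ps) (γ-spec _) (γ-spec _)

  γG+2≤γ-after-all : γ G + 2 ≤ γ-after allPairs
  γG+2≤γ-after-all =
    isolating-triple-adds-two {G = G} {u} {v} {w} v~u v~w u≢w (γ-spec G)
      (IsDominationNumber-cong {G = G ─ restrictTo I allPairs} {G ─ I}
        (─-cong {E = restrictTo I allPairs} {F = I} (restrictTo-allPairs I)) (γ-spec _))

module _ {n} {G : Graph n} where

  ∑∑-endpoint≡∑-deg : (T : VSet n) →
                      ∑[ i < n ] ∑[ j < n ] χ (T i ∧ adj G i j) ≡ ∑[ i < n ] (χ (T i) * deg G i)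
  ∑∑-endpoint≡∑-deg T = sum-cong-≗ λ i → begin
    ∑[ j < n ] χ (T i ∧ adj G i j)        ≡⟨ sum-cong-≗ (λ j → χ-∧ (T i) (adj G i j)) ⟩
    ∑[ j < n ] (χ (T i) * χ (adj G i j))  ≡⟨ *-distribˡ-sum (χ (T i)) (λ j → χ (adj G i j)) ⟨
    χ (T i) * ∑[ j < n ] χ (adj G i j)    ≡⟨ cong (χ (T i) *_) (count≡∑ (adj G i)) ⟨
    χ (T i) * deg G i                     ∎
    where open ≡-Reasoning

  esize-incident+inside : (T : VSet n) →
                          esize (incident G T) + esize (inside G T) ≡ ∑[ i < n ] (χ (T i) * deg G i)
  esize-incident+inside T = *-cancelˡ-≡ _ _ 2 (begin
    2 * (esize (incident G T) + esize (inside G T))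
      ≡⟨ *-distribˡ-+ 2 (esize (incident G T)) (esize (inside G T)) ⟩
    2 * esize (incident G T) + 2 * esize (inside G T)
      ≡⟨ cong₂ _+_ (handshake (incident G T)) (handshake (inside G T)) ⟩
    ∑[ i < n ] ∑[ j < n ] χ ((T i ∨ T j) ∧ adj G i j) +
    ∑[ i < n ] ∑[ j < n ] χ ((T i ∧ T j) ∧ adj G i j)
      ≡⟨ ∑∑-distrib-+ (λ i j → χ ((T i ∨ T j) ∧ adj G i j))
                      (λ i j → χ ((T i ∧ T j) ∧ adj G i j)) ⟨
    ∑[ i < n ] ∑[ j < n ] (χ ((T i ∨ T j) ∧ adj G i j) + χ ((T i ∧ T j) ∧ adj G i j))
      ≡⟨ sum-cong-≗ (λ i → sum-cong-≗ λ j → χ-∨-∧ (T i) (T j) (adj G i j)) ⟩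
    ∑[ i < n ] ∑[ j < n ] (χ (T i ∧ adj G i j) + χ (T j ∧ adj G i j))
      ≡⟨ ∑∑-distrib-+ (λ i j → χ (T i ∧ adj G i j)) (λ i j → χ (T j ∧ adj G i j)) ⟩
    D + ∑[ i < n ] ∑[ j < n ] χ (T j ∧ adj G i j)
      ≡⟨ cong (D +_) (trans (∑-comm (λ i j → χ (T j ∧ adj G i j)))
                            (sum-cong-≗ λ i → sum-cong-≗ λ j →
                               cong (λ b → χ (T i ∧ b)) (adj-sym G j i))) ⟩
    D + D
      ≡⟨ cong₂ _+_ (∑∑-endpoint≡∑-deg T)
                   (trans (∑∑-endpoint≡∑-deg T) (sym (+-identityʳ _))) ⟩
    2 * ∑[ i < n ] (χ (T i) * deg G i)
      ∎)
    where
    open ≡-Reasoning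
    D = ∑[ i < n ] ∑[ j < n ] χ (T i ∧ adj G i j)

module _ {n} {u v w : Fin n} (u≢v : u ≢ v) (v≢w : v ≢ w) (u≢w : u ≢ w) where

  χ-triple : ∀ i → χ (triple u v w i) ≡ χ (⁅ u ⁆ i) + χ (⁅ v ⁆ i) + χ (⁅ w ⁆ i)
  χ-triple i with i ≟ u | i ≟ v | i ≟ w
  ... | yes i≡u | yes i≡v | _       = contradiction (trans (sym i≡u) i≡v) u≢v
  ... | yes i≡u | _       | yes i≡w = contradiction (trans (sym i≡u) i≡w) u≢w
  ... | _       | yes i≡v | yes i≡w = contradiction (trans (sym i≡v) i≡w) v≢w
  ... | yes _   | no _    | no _    = refl
  ... | no _    | yes _   | no _    = refl
  ... | no _    | no _    | yes _   = refl
  ... | no _    | no _    | no _    = refl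

  ∑-triple : (h : Fin n → ℕ) → ∑[ i < n ] (χ (triple u v w i) * h i) ≡ h u + h v + h w
  ∑-triple h = begin
    ∑[ i < n ] (χ (triple u v w i) * h i)
      ≡⟨ sum-cong-≗ (λ i → trans (cong (_* h i) (χ-triple i)) (distrib i)) ⟩
    ∑[ i < n ] (δ u i + δ v i + δ w i)
      ≡⟨ ∑-distrib-+ (λ i → δ u i + δ v i) (δ w) ⟩
    ∑[ i < n ] (δ u i + δ v i) + ∑[ i < n ] δ w i
      ≡⟨ cong (_+ ∑[ i < n ] δ w i) (∑-distrib-+ (δ u) (δ v)) ⟩
    ∑[ i < n ] δ u i + ∑[ i < n ] δ v i + ∑[ i < n ] δ w i
      ≡⟨ cong₂ _+_ (cong₂ _+_ (∑-⁅⁆ u h) (∑-⁅⁆ v h)) (∑-⁅⁆ w h) ⟩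
    h u + h v + h w
      ∎
    where
    open ≡-Reasoning
    δ : Fin n → Fin n → ℕ
    δ x i = χ (⁅ x ⁆ i) * h i
    distrib : ∀ i → (χ (⁅ u ⁆ i) + χ (⁅ v ⁆ i) + χ (⁅ w ⁆ i)) * h i ≡ δ u i + δ v i + δ w i
    distrib i = trans (*-distribʳ-+ (h i) (χ (⁅ u ⁆ i) + χ (⁅ v ⁆ i)) (χ (⁅ w ⁆ i)))
                      (cong (_+ δ w i) (*-distribʳ-+ (h i) (χ (⁅ u ⁆ i)) (χ (⁅ v ⁆ i))))

  esize-inside-triple : (G : Graph n) → esize (inside G (triple u v w)) ≡ σ G u v w
  esize-inside-triple G = *-cancelˡ-≡ _ _ 2 (begin
    2 * esize (inside G T)
      ≡⟨ handshake (inside G T) ⟩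
    ∑[ i < n ] ∑[ j < n ] χ ((T i ∧ T j) ∧ adj G i j)
      ≡⟨ sum-cong-≗ (λ i → sum-cong-≗ λ j → χ-∧∧ (T i) (T j) (adj G i j)) ⟩
    ∑[ i < n ] ∑[ j < n ] (χ (T i) * (χ (T j) * e i j))
      ≡⟨ sum-cong-≗ (λ i → *-distribˡ-sum (χ (T i)) (λ j → χ (T j) * e i j)) ⟨
    ∑[ i < n ] (χ (T i) * ∑[ j < n ] (χ (T j) * e i j))
      ≡⟨ sum-cong-≗ (λ i → cong (χ (T i) *_) (∑-triple (e i))) ⟩
    ∑[ i < n ] (χ (T i) * (e i u + e i v + e i w))
      ≡⟨ ∑-triple (λ i → e i u + e i v + e i w) ⟩
    (e u u + e u v + e u w) + (e v u + e v v + e v w) + (e w u + e w v + e w w)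
      ≡⟨ cong₂ _+_ (cong₂ _+_ (cong (λ z → z + e u v + e u w) (irrefl u))
                              (cong₂ _+_ (cong₂ _+_ (symm v u) (irrefl v)) refl))
                   (cong₂ _+_ (cong₂ _+_ (symm w u) (symm w v)) (irrefl w)) ⟩
    (0 + e u v + e u w) + (e u v + 0 + e v w) + (e u w + e v w + 0)
      ≡⟨ solve 3 (λ p q r → (con 0 :+ p :+ r) :+ (p :+ con 0 :+ q) :+ (r :+ q :+ con 0)
                            := con 2 :* (p :+ q :+ r)) refl (e u v) (e v w) (e u w) ⟩
    2 * σ G u v w
      ∎)
    where
    open ≡-Reasoning
    T : VSet n
    T = triple u v w
    e : Fin n → Fin n → ℕ
    e i j = χ (adj G i j)
    irrefl : ∀ i → e i i ≡ 0
    irrefl i = cong χ (adj-irrefl G i)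
    symm : ∀ i j → e i j ≡ e j i
    symm i j = cong χ (adj-sym G i j)
    χ-∧∧ : ∀ a b c → χ ((a ∧ b) ∧ c) ≡ χ a * (χ b * χ c)
    χ-∧∧ a b c =
      trans (χ-∧ (a ∧ b) c) (trans (cong (_* χ c) (χ-∧ a b)) (*-assoc (χ a) (χ b) (χ c)))

  esize-incident-triple : (G : Graph n) →
                          esize (incident G (triple u v w)) + σ G u v w ≡ deg G u + deg G v + deg G w
  esize-incident-triple G = begin
    esize (incident G T) + σ G u v w           ≡⟨ cong (esize (incident G T) +_) (esize-inside-triple G) ⟨
    esize (incident G T) + esize (inside G T)  ≡⟨ esize-incident+inside {G = G} T ⟩
    ∑[ i < n ] (χ (T i) * deg G i)             ≡⟨ ∑-triple (deg G) ⟩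
    deg G u + deg G v + deg G w                ∎
    where
    open ≡-Reasoning
    T : VSet n
    T = triple u v w

theorem4 : ∀ {n} (G : Graph n) (u v w : Fin n) → u ≢ w →
           adj G v u ≡ true → adj G v w ≡ true →
           ∃[ s ] (IsSb2 G s × s ≤ deg G u + deg G v + deg G w ∸ σ G u v w)
theorem4 G u v w u≢w v~u v~w =
  let E , witness , E⊆I = bondage2-witness-within-incident {G = G} {u} {v} {w} u≢w v~u v~w
      s , isSb2 , s≤|E| = Sb₂-exists E witness
  in  s , isSb2 , (begin
    s                                        ≤⟨ s≤|E| ⟩
    esize E                                  ≤⟨ esize-mono {E = E} {F = I} E⊆I ⟩
    esize I                                  ≡⟨ m+n∸n≡m (esize I) (σ G u v w) ⟨
    esize I + σ G u v w ∸ σ G u v w          ≡⟨ cong (_∸ σ G u v w) |I|+σ≡Σdeg ⟩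
    deg G u + deg G v + deg G w ∸ σ G u v w  ∎)
  where
  open ≤-Reasoning
  I : EdgeSet G
  I = incident G (triple u v w)
  |I|+σ≡Σdeg : esize I + σ G u v w ≡ deg G u + deg G v + deg G w
  |I|+σ≡Σdeg = esize-incident-triple (adj⇒≢ G v~u ∘ sym) (adj⇒≢ G v~w) u≢w G
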